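{- Let $G$ be an Eulerian graph and $T$ a spanning tree of $G$. Then $|\operatorname{supp}(\gamma_T)|$ has the same parity as the number of edges of $G$.
   Context: A graph is connected and finite, loops and multiple edges allowed; it is Eulerian if it has a closed walk traversing every edge exactly once. $E^c(T)$ is the set of edges not in $T$; $M_2(E^c(T))$ is the $\mathbb Z/2\mathbb Z$-vector space of formal sums $\gamma=\sum_{e\in E^c(T)}c_e e$, $\operatorname{supp}(\gamma)=\{e:c_e=1\}$. The canonical element $\gamma_T$ has $c_e=0$ if the unique path in $T$ joining the endpoints of $e$ has odd length, and $c_e=1$ otherwise. -}

module Defs where

open import Data.Nat using (ℕ; zero; suc; _+_; _≥_; NonZero)
open import Data.Bool using (Bool; true; false; not; if_then_else_)
open import Data.Fin using (Fin; zero; suc)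
open import Data.List using (List; []; _∷_; _++_; length)
open import Data.List.Relation.Unary.All using (All)
open import Data.List.Relation.Unary.Unique.Propositional using (Unique)
open import Data.List.Relation.Binary.Permutation.Propositional using (_↭_)
open import Data.List using (allFin)
open import Data.Product using (Σ; _×_; ∃)
open import Data.Sum using (_⊎_)
open import Relation.Binary.PropositionalEquality using (_≡_)
open import Relation.Nullary using (¬_)

-- A finite graph with vertex set Fin n and edge set Fin m.
-- Each edge has two (ordered, for bookkeeping) endpoints; loops
-- (both endpoints equal) and multiple edges are allowed.
record Graph : Set where
  field
    n    : ℕ
    m    : ℕ
    src  : Fin m → Fin n
    tgt  : Fin m → Fin n

module _ (G : Graph) where
  open Graph G

  Traverses : Fin m → Fin n → Fin n → Set
  Traverses e u w = (src e ≡ u × tgt e ≡ w) ⊎ (src e ≡ w × tgt e ≡ u)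

  data Walk : Fin n → Fin n → Set where
    nil  : ∀ {u} → Walk u u
    cons : ∀ {u w v} (e : Fin m) → Traverses e u w → Walk w v → Walk u v

  edgesOf : ∀ {u v} → Walk u v → List (Fin m)
  edgesOf nil = []
  edgesOf (cons e _ p) = e ∷ edgesOf p

  len : ∀ {u v} → Walk u v → ℕ
  len p = length (edgesOf p)

  -- starting vertices of each step (for a closed walk: the vertices
  -- of the walk without repeating the final vertex)
  startsOf : ∀ {u v} → Walk u v → List (Fin n)
  startsOf nil = []
  startsOf {u} (cons e _ p) = u ∷ startsOf p

  verticesOf : ∀ {u v} → Walk u v → List (Fin n)
  verticesOf {v = v} p = startsOf p ++ (v ∷ [])

  EdgeSet : Set
  EdgeSet = Fin m → Bool

  WalkIn : EdgeSet → ∀ {u v} → Walk u v → Set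
  WalkIn T p = All (λ e → T e ≡ true) (edgesOf p)

  IsPath : ∀ {u v} → Walk u v → Set
  IsPath p = Unique (verticesOf p)

  -- a cycle: a nonempty closed walk with no repeated edge and no
  -- repeated vertex other than start = end (loops and pairs of parallel
  -- edges are cycles)
  IsCycle : ∀ {v} → Walk v v → Set
  IsCycle p = (len p ≥ 1) × Unique (edgesOf p) × Unique (startsOf p)

  Connected : Set
  Connected = NonZero n × (∀ u v → Walk u v)

  Eulerian : Set
  Eulerian = Connected × Σ (Fin n) (λ v → Σ (Walk v v) (λ p → edgesOf p ↭ allFin m))

  SpanningTree : EdgeSet → Set
  SpanningTree T =
    (∀ u v → Σ (Walk u v) (λ p → WalkIn T p)) ×
    (∀ v (p : Walk v v) → WalkIn T p → ¬ IsCycle p)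

  isEven : ℕ → Bool
  isEven zero = true
  isEven (suc k) = not (isEven k)

  -- c : Fin m → Bool encodes γ = Σ c_e e in M_2(E^c(T)) (c is false on
  -- tree edges, which are not in E^c(T)); c is the canonical element γ_T:
  -- for e ∉ T, c_e = 1 iff the (unique) path in T joining the endpoints
  -- of e has even length
  IsCanonical : EdgeSet → (Fin m → Bool) → Set
  IsCanonical T c = ∀ e →
    (T e ≡ true → c e ≡ false) ×
    (T e ≡ false → (p : Walk (src e) (tgt e)) → WalkIn T p → IsPath p →
        c e ≡ isEven (len p))

countTrue : ∀ {k} → (Fin k → Bool) → ℕ
countTrue {zero} c = 0
countTrue {suc k} c = (if c zero then 1 else 0) + countTrue (λ i → c (suc i))

module Submission where

-- Colour every vertex by the parity of the length of a T-walk to it from a fixed root. A closed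
-- walk in T that is not a cycle revisits a vertex or an edge, and cutting it there leaves two
-- shorter walks whose lengths have the same total parity; as T has no cycles, induction shows that
-- every closed T-walk is even. So all T-walks between two vertices have the parity of the sum of
-- their colours, and γ_T is exactly the set of edges whose ends have equal colours. Along an
-- Euler tour the colour changes an even number of times, so an even number of edges have ends of
-- different colours, and |supp γ_T| ≡ m (mod 2).

open import Defs
open import Data.Nat using (ℕ; zero; suc; _+_; _≤_; _<_; _%_; s≤s; z≤n)
open import Data.Nat.Properties
  using (+-comm; +-suc; ≤-trans; <-≤-trans; ≤-reflexive; m≤m+n; m≤n+m; n≤1+n; m<m+n; m<n⇒m<1+n)
open import Data.Nat.Divisibility using (_∣_; _∣0; ∣-refl; ∣m∣n⇒∣m+n)
open import Data.Nat.DivMod using (%-remove-+ʳ)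
open import Data.Nat.Induction using (<-wellFounded)
open import Data.Bool using (Bool; true; false; not; _xor_; if_then_else_)
open import Data.Bool.Properties
  using ( not-involutive; not-distribˡ-xor; not-distribʳ-xor
        ; xor-same; xor-comm; xor-assoc; xor-∧-commutativeRing)
open import Data.Fin using (Fin; _≟_)
open import Data.List using (List; []; _∷_; foldr; map; tabulate; allFin)
open import Data.List.Properties using (map-tabulate)
open import Data.List.Membership.Propositional using (_∈_)
open import Data.List.Relation.Unary.Any using (here; there; any?)
open import Data.List.Relation.Unary.All using ([]; _∷_)
open import Data.List.Relation.Unary.All.Properties using (¬Any⇒All¬)
open import Data.List.Relation.Unary.AllPairs using ([]; _∷_)
open import Data.List.Relation.Unary.Unique.Propositional using (Unique)
open import Data.List.Relation.Binary.Permutation.Propositional using (_↭_; ↭⇒↭ₛ)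
open import Data.List.Relation.Binary.Permutation.Propositional.Properties using (map⁺)
open import Data.List.Relation.Binary.Permutation.Setoid.Properties using (foldr-commMonoid)
open import Data.Product using (Σ; ∃; _×_; _,_; proj₁; proj₂)
open import Data.Sum using (_⊎_; inj₁; inj₂)
import Data.Sum as Sum
open import Data.Empty using (⊥-elim)
open import Function using (_∘_)
open import Induction.WellFounded using (Acc; acc)
open import Algebra.Bundles using (CommutativeRing)
open import Relation.Nullary using (¬_; yes; no)
open import Relation.Binary.PropositionalEquality
  using (_≡_; refl; sym; trans; cong; cong₂; setoid; module ≡-Reasoning)

open ≡-Reasoning

odd : ℕ → Bool
odd zero    = false
odd (suc n) = not (odd n)

odd-+ : ∀ m n → odd (m + n) ≡ odd m xor odd n
odd-+ zero    n = refl
odd-+ (suc m) n = trans (cong not (odd-+ m n)) (not-distribˡ-xor (odd m) (odd n))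

odd≡false⇒2∣ : ∀ n → odd n ≡ false → 2 ∣ n
odd≡false⇒2∣ zero          _ = 2 ∣0
odd≡false⇒2∣ (suc (suc n)) h =
  ∣m∣n⇒∣m+n ∣-refl (odd≡false⇒2∣ n (trans (sym (not-involutive (odd n))) h))

isEven≡not-odd : ∀ G n → isEven G n ≡ not (odd n)
isEven≡not-odd G zero    = refl
isEven≡not-odd G (suc n) = cong not (isEven≡not-odd G n)

xor-cancelˡ : ∀ a x → a xor (a xor x) ≡ x
xor-cancelˡ false x = refl
xor-cancelˡ true  x = not-involutive x

xor≡false⇒≡ : ∀ x y → x xor y ≡ false → x ≡ y
xor≡false⇒≡ false y     h = sym h
xor≡false⇒≡ true  true  _ = refl
xor≡false⇒≡ true  false ()

xor-telescope : ∀ a b c → (a xor b) xor (b xor c) ≡ a xor c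
xor-telescope a b c = begin
  (a xor b) xor (b xor c)  ≡⟨ xor-assoc a b (b xor c) ⟩
  a xor (b xor (b xor c))  ≡⟨ cong (a xor_) (xor-cancelˡ b c) ⟩
  a xor c                  ∎

xorSum : List Bool → Bool
xorSum = foldr _xor_ false

xorSum-↭ : ∀ {xs ys} → xs ↭ ys → xorSum xs ≡ xorSum ys
xorSum-↭ xs↭ys = foldr-commMonoid (setoid Bool)
  (CommutativeRing.+-isCommutativeMonoid xor-∧-commutativeRing) (↭⇒↭ₛ xs↭ys)

odd-countTrue : ∀ {k} (f : Fin k → Bool) → odd (countTrue f) ≡ xorSum (tabulate f)
odd-countTrue {zero}  f = refl
odd-countTrue {suc k} f = begin
  odd ((if f Fin.zero then 1 else 0) + countTrue (f ∘ Fin.suc))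
    ≡⟨ odd-+ (if f Fin.zero then 1 else 0) (countTrue (f ∘ Fin.suc)) ⟩
  odd (if f Fin.zero then 1 else 0) xor odd (countTrue (f ∘ Fin.suc))
    ≡⟨ cong₂ _xor_ (odd-indicator (f Fin.zero)) (odd-countTrue (f ∘ Fin.suc)) ⟩
  f Fin.zero xor xorSum (tabulate (f ∘ Fin.suc))
    ∎
  where
  odd-indicator : ∀ b → odd (if b then 1 else 0) ≡ b
  odd-indicator true  = refl
  odd-indicator false = refl

countTrue-complement : ∀ {k} (f g : Fin k → Bool) → (∀ i → f i ≡ not (g i)) →
                       countTrue f + countTrue g ≡ k
countTrue-complement {zero}  f g f≡¬g = refl
countTrue-complement {suc k} f g f≡¬g
  with f Fin.zero | g Fin.zero | f≡¬g Fin.zero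
     | countTrue-complement (f ∘ Fin.suc) (g ∘ Fin.suc) (f≡¬g ∘ Fin.suc)
... | true  | false | refl | rest = cong suc rest
... | false | true  | refl | rest = trans (+-suc _ _) (cong suc rest)

module _ (G : Graph) where
  open Graph G

  coboundary : (Fin n → Bool) → Fin m → Bool
  coboundary f e = f (src e) xor f (tgt e)

  coboundary-traverses : ∀ f {e u w} → Traverses G e u w → coboundary f e ≡ f u xor f w
  coboundary-traverses f (inj₁ (refl , refl)) = refl
  coboundary-traverses f {e} (inj₂ (refl , refl)) = xor-comm (f (src e)) (f (tgt e))

  xorSum-coboundary : ∀ f {u v} (p : Walk G u v) →
                      xorSum (map (coboundary f) (edgesOf G p)) ≡ f u xor f v
  xorSum-coboundary f {u} nil = sym (xor-same (f u))
  xorSum-coboundary f {u} {v} (cons {w = w} e t p) = begin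
    coboundary f e xor xorSum (map (coboundary f) (edgesOf G p))
      ≡⟨ cong₂ _xor_ (coboundary-traverses f t) (xorSum-coboundary f p) ⟩
    (f u xor f w) xor (f w xor f v)  ≡⟨ xor-telescope (f u) (f w) (f v) ⟩
    f u xor f v                      ∎

  Eulerian⇒2∣countTrue-coboundary : Eulerian G → ∀ f → 2 ∣ countTrue (coboundary f)
  Eulerian⇒2∣countTrue-coboundary (_ , v , tour , tour↭all) f =
    odd≡false⇒2∣ (countTrue (coboundary f)) (begin
      odd (countTrue (coboundary f))
        ≡⟨ odd-countTrue (coboundary f) ⟩
      xorSum (tabulate (coboundary f))
        ≡⟨ cong xorSum (map-tabulate (λ e → e) (coboundary f)) ⟨
      xorSum (map (coboundary f) (allFin m))
        ≡⟨ xorSum-↭ (map⁺ (coboundary f) tour↭all) ⟨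
      xorSum (map (coboundary f) (edgesOf G tour))
        ≡⟨ xorSum-coboundary f tour ⟩
      f v xor f v
        ≡⟨ xor-same (f v) ⟩
      false
        ∎)

  traverses-ends : ∀ {e u w x y} → Traverses G e u w → Traverses G e x y →
                   (x ≡ u × y ≡ w) ⊎ (x ≡ w × y ≡ u)
  traverses-ends (inj₁ (refl , refl)) (inj₁ (refl , refl)) = inj₁ (refl , refl)
  traverses-ends (inj₁ (refl , refl)) (inj₂ (refl , refl)) = inj₂ (refl , refl)
  traverses-ends (inj₂ (refl , refl)) (inj₁ (refl , refl)) = inj₂ (refl , refl)
  traverses-ends (inj₂ (refl , refl)) (inj₂ (refl , refl)) = inj₁ (refl , refl)

  Acyclic : EdgeSet G → Set
  Acyclic T = ∀ v (p : Walk G v v) → WalkIn G T p → ¬ IsCycle G p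

  module _ (T : EdgeSet G) where

    data TWalk : Fin n → Fin n → Set where
      nil  : ∀ {u} → TWalk u u
      cons : ∀ {u w v} e → Traverses G e u w → T e ≡ true → TWalk w v → TWalk u v

    toWalk : ∀ {u v} → TWalk u v → Walk G u v
    toWalk nil            = nil
    toWalk (cons e t _ p) = cons e t (toWalk p)

    toWalk-in : ∀ {u v} (p : TWalk u v) → WalkIn G T (toWalk p)
    toWalk-in nil              = []
    toWalk-in (cons _ _ e∈T p) = e∈T ∷ toWalk-in p

    fromWalk : ∀ {u v} (p : Walk G u v) → WalkIn G T p → TWalk u v
    fromWalk nil          _           = nil
    fromWalk (cons e t p) (e∈T ∷ p∈T) = cons e t e∈T (fromWalk p p∈T)

    length : ∀ {u v} → TWalk u v → ℕ
    length p = len G (toWalk p)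

    starts : ∀ {u v} → TWalk u v → List (Fin n)
    starts p = startsOf G (toWalk p)

    vertices : ∀ {u v} → TWalk u v → List (Fin n)
    vertices p = verticesOf G (toWalk p)

    edges : ∀ {u v} → TWalk u v → List (Fin m)
    edges p = edgesOf G (toWalk p)

    infixr 5 _++_
    _++_ : ∀ {u v w} → TWalk u v → TWalk v w → TWalk u w
    nil            ++ q = q
    cons e t e∈T p ++ q = cons e t e∈T (p ++ q)

    length-++ : ∀ {u v w} (p : TWalk u v) (q : TWalk v w) →
                length (p ++ q) ≡ length p + length q
    length-++ nil            q = refl
    length-++ (cons _ _ _ p) q = cong suc (length-++ p q)

    reverse : ∀ {u v} → TWalk u v → TWalk v u
    reverse nil              = nil
    reverse (cons e t e∈T p) = reverse p ++ cons e (Sum.swap t) e∈T nil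

    length-reverse : ∀ {u v} (p : TWalk u v) → length (reverse p) ≡ length p
    length-reverse nil              = refl
    length-reverse (cons e t e∈T p) = begin
      length (reverse p ++ cons e (Sum.swap t) e∈T nil) ≡⟨ length-++ (reverse p) _ ⟩
      length (reverse p) + 1                            ≡⟨ cong (_+ 1) (length-reverse p) ⟩
      length p + 1                                      ≡⟨ +-comm (length p) 1 ⟩
      suc (length p)                                    ∎

    dropUntil : ∀ {u v x} (p : TWalk u v) → x ∈ vertices p → TWalk x v
    dropUntil nil              (here refl) = nil
    dropUntil p@(cons _ _ _ _) (here refl) = p
    dropUntil (cons _ _ _ p)   (there x∈)  = dropUntil p x∈

    dropUntil-isPath : ∀ {u v x} (p : TWalk u v) (x∈ : x ∈ vertices p) →
                       IsPath G (toWalk p) → IsPath G (toWalk (dropUntil p x∈))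
    dropUntil-isPath nil            (here refl) p-path       = p-path
    dropUntil-isPath (cons _ _ _ _) (here refl) p-path       = p-path
    dropUntil-isPath (cons _ _ _ p) (there x∈)  (_ ∷ p-path) = dropUntil-isPath p x∈ p-path

    toPath : ∀ {u v} → TWalk u v → Σ (TWalk u v) (λ q → IsPath G (toWalk q))
    toPath nil = nil , [] ∷ []
    toPath {u} (cons e t e∈T p) with toPath p
    ... | q , q-path with any? (u ≟_) (vertices q)
    ...   | yes u∈ = dropUntil q u∈ , dropUntil-isPath q u∈ q-path
    ...   | no  u∉ = cons e t e∈T q , ¬Any⇒All¬ _ u∉ ∷ q-path

    record Split {u v} (p : TWalk u v) (x : Fin n) (e : Fin m) : Set where
      constructor split
      field
        {y}    : Fin n
        before : TWalk u x
        step   : Traverses G e x y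
        e∈T    : T e ≡ true
        after  : TWalk y v
        p≡     : p ≡ before ++ cons e step e∈T after

    split-at-start : ∀ {u v x} (p : TWalk u v) → x ∈ starts p → ∃ (Split p x)
    split-at-start (cons e t e∈T p) (here refl) = e , split nil t e∈T p refl
    split-at-start (cons e t e∈T p) (there x∈) with split-at-start p x∈
    ... | e′ , split s t′ e′∈T r refl = e′ , split (cons e t e∈T s) t′ e′∈T r refl

    split-at-edge : ∀ {u v e} (p : TWalk u v) → e ∈ edges p → ∃ λ x → Split p x e
    split-at-edge (cons e t e∈T p) (here refl) = _ , split nil t e∈T p refl
    split-at-edge (cons e t e∈T p) (there e∈) with split-at-edge p e∈
    ... | x , split s t′ e′∈T r refl = x , split (cons e t e∈T s) t′ e′∈T r refl

    record Decomposition {u v} (p : TWalk u v) : Set where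
      constructor decomposition
      field
        {x}        : Fin n
        loop       : TWalk x x
        rest       : TWalk u v
        loop<      : length loop < length p
        rest<      : length rest < length p
        odd-length : odd (length p) ≡ odd (length loop) xor odd (length rest)

    odd-length-++ : ∀ {u v w} (p : TWalk u v) (q : TWalk v w) →
                    odd (length (p ++ q)) ≡ odd (length p) xor odd (length q)
    odd-length-++ p q = trans (cong odd (length-++ p q)) (odd-+ (length p) (length q))

    decomposition-cons : ∀ {u w v} e (t : Traverses G e u w) e∈T {p : TWalk w v} →
                         Decomposition p → Decomposition (cons e t e∈T p)
    decomposition-cons e t e∈T (decomposition loop rest loop< rest< odd-length) =
      decomposition loop (cons e t e∈T rest) (m<n⇒m<1+n loop<) (s≤s rest<)
        (trans (cong not odd-length) (not-distribʳ-xor (odd (length loop)) (odd (length rest))))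

    returning-decomposition : ∀ {u w v} e (t : Traverses G e u w) e∈T
                              (s : TWalk w u) (q : TWalk u v) → 0 < length q →
                              Decomposition (cons e t e∈T (s ++ q))
    returning-decomposition e t e∈T s q q>0 =
      decomposition (cons e t e∈T s) q
        (s≤s (<-≤-trans (m<m+n (length s) q>0) (≤-reflexive (sym (length-++ s q)))))
        (s≤s (≤-trans (m≤n+m (length q) (length s)) (≤-reflexive (sym (length-++ s q)))))
        (trans (cong not (odd-length-++ s q)) (not-distribˡ-xor (odd (length s)) (odd (length q))))

    backtracking-decomposition : ∀ {u w v} e (t : Traverses G e u w) e∈T (s : TWalk w w)
                                 e′ (t′ : Traverses G e′ w u) e′∈T (r : TWalk u v) →
                                 Decomposition (cons e t e∈T (s ++ cons e′ t′ e′∈T r))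
    backtracking-decomposition e t e∈T s e′ t′ e′∈T r =
      decomposition s r
        (s≤s (≤-trans (m≤m+n (length s) (length r)) (≤-trans (n≤1+n _) (≤-reflexive (sym L)))))
        (s≤s (≤-trans (m≤n+m (length r) (length s)) (≤-trans (n≤1+n _) (≤-reflexive (sym L)))))
        (begin
          not (odd (length (s ++ cons e′ t′ e′∈T r))) ≡⟨ cong (not ∘ odd) L ⟩
          not (not (odd (length s + length r)))      ≡⟨ not-involutive _ ⟩
          odd (length s + length r)                  ≡⟨ odd-+ (length s) (length r) ⟩
          odd (length s) xor odd (length r)          ∎)
      where
      L : length (s ++ cons e′ t′ e′∈T r) ≡ suc (length s + length r)
      L = trans (length-++ s _) (+-suc (length s) (length r))

    starts-unique-or-decomposable : ∀ {u v} (p : TWalk u v) → Unique (starts p) ⊎ Decomposition p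
    starts-unique-or-decomposable nil = inj₁ []
    starts-unique-or-decomposable {u} (cons e t e∈T p) with any? (u ≟_) (starts p)
    ... | no u∉ =
      Sum.map (¬Any⇒All¬ _ u∉ ∷_) (decomposition-cons e t e∈T) (starts-unique-or-decomposable p)
    ... | yes u∈ with split-at-start p u∈
    ...   | e′ , split s t′ e′∈T r refl =
      inj₂ (returning-decomposition e t e∈T s (cons e′ t′ e′∈T r) (s≤s z≤n))

    edges-unique-or-decomposable : ∀ {u v} (p : TWalk u v) → Unique (edges p) ⊎ Decomposition p
    edges-unique-or-decomposable nil = inj₁ []
    edges-unique-or-decomposable (cons e t e∈T p) with any? (e ≟_) (edges p)
    ... | no e∉ =
      Sum.map (¬Any⇒All¬ _ e∉ ∷_) (decomposition-cons e t e∈T) (edges-unique-or-decomposable p)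
    ... | yes e∈ with split-at-edge p e∈
    ...   | _ , split s t′ e′∈T r refl with traverses-ends t t′
    ...     | inj₁ (refl , refl) =
      inj₂ (returning-decomposition e t e∈T s (cons e t′ e′∈T r) (s≤s z≤n))
    ...     | inj₂ (refl , refl) =
      inj₂ (backtracking-decomposition e t e∈T s e t′ e′∈T r)

    module _ (acyclic : Acyclic T) where

      closed-TWalk-decomposable : ∀ {v} (c : TWalk v v) → 1 ≤ length c → Decomposition c
      closed-TWalk-decomposable {v} c 1≤c
        with starts-unique-or-decomposable c | edges-unique-or-decomposable c
      ... | inj₂ d | _      = d
      ... | inj₁ _ | inj₂ d = d
      ... | inj₁ starts-unique | inj₁ edges-unique =
        ⊥-elim (acyclic v (toWalk c) (toWalk-in c) (1≤c , edges-unique , starts-unique))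

      closed-TWalk-even : ∀ {v} (c : TWalk v v) → odd (length c) ≡ false
      closed-TWalk-even c = closed-TWalk-even-acc c (<-wellFounded (length c))
        where
        closed-TWalk-even-acc : ∀ {v} (c : TWalk v v) → Acc _<_ (length c) → odd (length c) ≡ false
        closed-TWalk-even-acc nil _ = refl
        closed-TWalk-even-acc c@(cons _ _ _ _) (acc shorter)
          with closed-TWalk-decomposable c (s≤s z≤n)
        ... | decomposition loop rest loop< rest< odd-length = begin
          odd (length c)                        ≡⟨ odd-length ⟩
          odd (length loop) xor odd (length rest)
            ≡⟨ cong₂ _xor_ (closed-TWalk-even-acc loop (shorter loop<))
                           (closed-TWalk-even-acc rest (shorter rest<)) ⟩
          false                                 ∎

      TWalk-odd-length-unique : ∀ {u v} (p q : TWalk u v) → odd (length p) ≡ odd (length q)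
      TWalk-odd-length-unique p q = xor≡false⇒≡ (odd (length p)) (odd (length q)) (begin
        odd (length p) xor odd (length q)
          ≡⟨ cong ((odd (length p) xor_) ∘ odd) (length-reverse q) ⟨
        odd (length p) xor odd (length (reverse q))  ≡⟨ odd-length-++ p (reverse q) ⟨
        odd (length (p ++ reverse q))                ≡⟨ closed-TWalk-even (p ++ reverse q) ⟩
        false                                        ∎)

    module Colouring (tree : SpanningTree G T) (root : Fin n) where

      treeWalk : ∀ u v → TWalk u v
      treeWalk u v = fromWalk (proj₁ (proj₁ tree u v)) (proj₂ (proj₁ tree u v))

      colour : Fin n → Bool
      colour v = odd (length (treeWalk root v))

      odd-length≡coboundary : ∀ {u w} (p : TWalk u w) → odd (length p) ≡ colour u xor colour w
      odd-length≡coboundary {u} {w} p = begin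
        odd (length p)                                 ≡⟨ xor-cancelˡ (colour u) (odd (length p)) ⟨
        colour u xor (colour u xor odd (length p))     ≡⟨ cong (colour u xor_) (odd-length-++ ρu p) ⟨
        colour u xor odd (length (ρu ++ p))
          ≡⟨ cong (colour u xor_) (TWalk-odd-length-unique (proj₂ tree) (ρu ++ p) ρw) ⟩
        colour u xor colour w                          ∎
        where
        ρu : TWalk root u
        ρu = treeWalk root u
        ρw : TWalk root w
        ρw = treeWalk root w

      canonical≡not-coboundary : ∀ c → IsCanonical G T c → ∀ e → c e ≡ not (coboundary colour e)
      canonical≡not-coboundary c canonical e with T e in e∈T
      ... | true = begin
        c e                                      ≡⟨ proj₁ (canonical e) e∈T ⟩
        not (odd (length edge))                  ≡⟨ cong not (odd-length≡coboundary edge) ⟩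
        not (coboundary colour e)                ∎
        where
        edge : TWalk (src e) (tgt e)
        edge = cons e (inj₁ (refl , refl)) e∈T nil
      ... | false with toPath (treeWalk (src e) (tgt e))
      ...   | path , isPath = begin
        c e                                      ≡⟨ proj₂ (canonical e) e∈T (toWalk path) (toWalk-in path) isPath ⟩
        isEven G (length path)                   ≡⟨ isEven≡not-odd G (length path) ⟩
        not (odd (length path))                  ≡⟨ cong not (odd-length≡coboundary path) ⟩
        not (coboundary colour e)                ∎

lemma6p5 : (G : Graph) → Eulerian G → (T : EdgeSet G) → SpanningTree G T →
    (c : Fin (Graph.m G) → Bool) → IsCanonical G T c →
    countTrue c % 2 ≡ Graph.m G % 2
lemma6p5 G eulerian@(_ , root , _) T tree c canonical = begin
  countTrue c % 2                                       ≡⟨ %-remove-+ʳ (countTrue c) coboundary-even ⟨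
  (countTrue c + countTrue (coboundary G colour)) % 2   ≡⟨ cong (_% 2) complement ⟩
  Graph.m G % 2                                         ∎
  where
  open Colouring G T tree root
  coboundary-even : 2 ∣ countTrue (coboundary G colour)
  coboundary-even = Eulerian⇒2∣countTrue-coboundary G eulerian colour
  complement : countTrue c + countTrue (coboundary G colour) ≡ Graph.m G
  complement = countTrue-complement c (coboundary G colour) (canonical≡not-coboundary c canonical)
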